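{- For all $n\ge 3$, $\mathrm{r}_n(2143)=5\cdot 2^{n-2}-4$.
   Context: $\mathcal{S}_n$ is the set of permutations of $[n]$, $\pi^r$ the reversal of $\pi$. A word $w$ contains $\rho\in\mathcal{S}_k$ if some subsequence $w_{i_1}\cdots w_{i_k}$ ($i_1<\cdots<i_k$) satisfies $w_{i_a}\le w_{i_b}$ iff $\rho_a\le\rho_b$; otherwise it avoids $\rho$. $\mathcal{R}_n=\{\pi\pi^r:\pi\in\mathcal{S}_n\}$ (concatenation of $\pi$ with its reversal), and $\mathrm{r}_n(\rho)$ is the number of members of $\mathcal{R}_n$ avoiding $\rho$. -}

module Defs where

open import Data.Nat using (ℕ; suc; _≤_)
open import Data.Fin using (Fin; cast)
open import Data.List using (List; _∷_; []; _++_; reverse; map; upTo; length; lookup)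
open import Data.List.Relation.Binary.Sublist.Propositional using (_⊆_)
open import Data.List.Relation.Binary.Permutation.Propositional using (_↭_)
open import Data.List.Relation.Unary.Unique.Propositional using (Unique)
open import Data.List.Membership.Propositional using (_∈_)
open import Data.Product using (Σ; ∃; _×_)
open import Function.Bundles using (_⇔_)
open import Relation.Binary.PropositionalEquality using (_≡_)
open import Relation.Nullary using (¬_)

[_] : ℕ → List ℕ
[ n ] = map suc (upTo n)

IsPerm : ℕ → List ℕ → Set
IsPerm n π = π ↭ [ n ]

OrderIso : List ℕ → List ℕ → Set
OrderIso s ρ = Σ (length s ≡ length ρ) λ eq →
  ∀ (a b : Fin (length s)) →
    (lookup s a ≤ lookup s b) ⇔ (lookup ρ (cast eq a) ≤ lookup ρ (cast eq b))

Contains : List ℕ → List ℕ → Set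
Contains w ρ = ∃ λ s → (s ⊆ w) × OrderIso s ρ

Avoids : List ℕ → List ℕ → Set
Avoids w ρ = ¬ Contains w ρ

double : List ℕ → List ℕ
double π = π ++ reverse π

Counted : ℕ → List ℕ → List ℕ → Set
Counted n ρ π = IsPerm n π × Avoids (double π) ρ

HasCount : ℕ → List ℕ → ℕ → Set
HasCount n ρ c = ∃ λ (L : List (List ℕ)) →
  Unique L × (∀ π → π ∈ L ⇔ Counted n ρ π) × length L ≡ c

p2143 : List ℕ
p2143 = 2 ∷ 1 ∷ 4 ∷ 3 ∷ []

-- Sort the permutations π of [N] whose double ππʳ avoids 2143 by their first entry h. The two copies of h
-- sit at the two ends of ππʳ, and the first and last letters of 2143 are neither its smallest nor its
-- largest letter; so for h = 1 and for h = N no occurrence uses h, and π avoids 2143 iff π with h deleted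
-- does. If 3 ≤ h ≤ N - 2, the values h - 1, 1, N, h + 1 always contain an occurrence. For N ≥ 4 exactly
-- two avoiders start with 2, namely 2 N (N-1) ⋯ 4 followed by 1 3 or 3 1, and exactly two start with
-- N - 1, their complements. Hence r₃ = 6 and r_N = 2 r_{N-1} + 4, so r_N = 5 · 2^(N-2) - 4.

module Submission where

open import Defs
open import Data.Nat using (ℕ; zero; suc; _+_; _*_; _^_; _∸_; _≤_; _<_; _≤?_; z≤n; s≤s; z<s; s<s; pred)
open import Data.Nat.Properties
  using ( _≟_; <-irrefl; ≤-refl; ≤-reflexive; ≤-trans; ≤-pred; <-trans; ≤-<-trans; <-≤-trans
        ; <⇒≤; <⇒≢; >⇒≢; <⇒≱; ≮⇒≥; ≰⇒>; ≤∧≢⇒<; m≤n⇒m<n∨m≡n; m≤n+m; n<1+n; suc-injective; m+n∸n≡m )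
open import Data.Nat.Tactic.RingSolver using (solve-∀)
open import Data.Fin using (Fin; cast) renaming (zero to fzero; suc to fsuc)
open import Data.List using (List; []; _∷_; _++_; map; reverse; upTo; length; lookup)
open import Data.List.Properties
  using (length-map; map-∘; map-id; length-++; map-++; map-upTo; upTo-∷ʳ; reverse-++; unfold-reverse; ++-assoc
        ; ++-identityʳ; reverse-map; map-injective; ∷-injectiveʳ)
open import Data.List.Membership.Propositional using (_∈_)
open import Data.List.Membership.Propositional.Properties
  using (∈-lookup; ∈-map⁺; ∈-map⁻; ∈-++⁺ˡ; ∈-++⁺ʳ; ∈-++⁻; ∈-upTo⁺; ∈-upTo⁻)
open import Data.List.Relation.Unary.Any as Any using (here; there)
open import Data.List.Relation.Unary.All as All using (All; []; _∷_)
open import Data.List.Relation.Unary.All.Properties as All using ()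
open import Data.List.Relation.Unary.AllPairs using ([]; _∷_)
open import Data.List.Relation.Unary.Unique.Propositional using (Unique)
import Data.List.Relation.Unary.Unique.Propositional.Properties as Unique
open import Data.List.Relation.Binary.Disjoint.Propositional using (Disjoint)
open import Data.List.Relation.Binary.Sublist.Propositional
  using (_⊆_; []; _∷_; _∷ʳ_; ⊆-refl; ⊆-reflexive; ⊆-trans; from∈; minimum)
open import Data.List.Relation.Binary.Sublist.Propositional.Properties
  using (∷ʳ⁻; ++⁺; ++⁺ʳ; reverse⁺; reverse⁻; Any-resp-⊆)
  renaming (map⁺ to ⊆-map⁺)
open import Data.List.Relation.Binary.Permutation.Propositional
  using (_↭_; ↭-refl; ↭-reflexive; ↭-sym; ↭-trans; prep; swap; ↭⇒↭ₛ)
open import Data.List.Relation.Binary.Permutation.Propositional.Properties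
  using (∈-resp-↭; drop-mid; drop-∷; ↭-reverse; ↭-empty-inv; ↭-singleton-inv; ↭-map-inv; ∷↭∷ʳ)
  renaming (map⁺ to ↭-map⁺; ++⁺ʳ to ↭-++⁺ʳ)
open import Data.List.Relation.Binary.Permutation.Setoid.Properties
  using (Unique-resp-↭)
open import Data.Empty using (⊥; ⊥-elim)
open import Data.Product using (∃; _×_; _,_; proj₁; proj₂)
open import Data.Sum using (_⊎_; inj₁; inj₂; [_,_]′)
open import Function using (_∘_)
open import Function.Bundles using (_⇔_; mk⇔; Equivalence)
open import Relation.Binary.PropositionalEquality
  using (_≡_; _≢_; refl; sym; trans; cong; cong₂; subst; subst₂; setoid; module ≡-Reasoning)
open import Relation.Nullary using (¬_; yes; no)
open import Relation.Nullary.Decidable using (from-yes; _×-dec_)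

-- Occurrences of 2143

record Occ2143 (w : List ℕ) : Set where
  constructor occ
  field
    a b c d : ℕ
    sub : a ∷ b ∷ c ∷ d ∷ [] ⊆ w
    b<a : b < a
    a<d : a < d
    d<c : d < c

private variable
  a b c d h m n x y z : ℕ
  s w w′ ws π σ τ ρ : List ℕ

lookup-map : ∀ (f : ℕ → ℕ) xs i → lookup (map f xs) i ≡ f (lookup xs (cast (length-map f xs) i))
lookup-map f (x ∷ xs) fzero    = refl
lookup-map f (x ∷ xs) (fsuc i) = lookup-map f xs i

map-orderIso : ∀ (f : ℕ → ℕ) ρ →
               (∀ {x y} → x ∈ ρ → y ∈ ρ → x < y → f x < f y) → OrderIso (map f ρ) ρ
map-orderIso f ρ mono = length-map f ρ , λ i j →
  subst₂ (λ u v → (u ≤ v) ⇔ (ρ[ i ] ≤ ρ[ j ])) (sym (lookup-map f ρ i)) (sym (lookup-map f ρ j))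
         (reflects (∈-lookup _) (∈-lookup _))
  where
  ρ[_] : Fin (length (map f ρ)) → ℕ
  ρ[ i ] = lookup ρ (cast (length-map f ρ) i)

  reflects : x ∈ ρ → y ∈ ρ → (f x ≤ f y) ⇔ (x ≤ y)
  reflects x∈ y∈ = mk⇔
    (λ fx≤fy → ≮⇒≥ (λ y<x → <⇒≱ (mono y∈ x∈ y<x) fx≤fy))
    (λ x≤y → [ <⇒≤ ∘ mono x∈ y∈ , (λ { refl → ≤-reflexive refl }) ]′ (m≤n⇒m<n∨m≡n x≤y))

<-from-steps : ∀ {f : ℕ → ℕ} {lo hi} → (∀ {x} → lo ≤ x → x < hi → f x < f (suc x)) →
               ∀ {x y} → lo ≤ x → y ≤ hi → x < y → f x < f y
<-from-steps step {x} {suc y} lo≤x y<hi (s≤s x≤y) with m≤n⇒m<n∨m≡n x≤y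
... | inj₂ refl = step lo≤x y<hi
... | inj₁ x<y  = <-trans (<-from-steps step lo≤x (<⇒≤ y<hi) x<y) (step (≤-trans lo≤x (<⇒≤ x<y)) y<hi)

-- increasing on 1 … 4 when b < a < d < c, and it maps 2143 to a b c d
relabel : ℕ → ℕ → ℕ → ℕ → ℕ → ℕ
relabel a b c d 1 = b
relabel a b c d 2 = a
relabel a b c d 3 = d
relabel a b c d _ = c

occ⇒contains : Occ2143 w → Contains w p2143
occ⇒contains (occ a b c d sub b<a a<d d<c) =
  a ∷ b ∷ c ∷ d ∷ [] , sub , map-orderIso (relabel a b c d) p2143 mono
  where
  step : 1 ≤ x → x < 4 → relabel a b c d x < relabel a b c d (suc x)
  step {0} () _
  step {1} _ _ = b<a
  step {2} _ _ = a<d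
  step {3} _ _ = d<c
  step {suc (suc (suc (suc _)))} _ (s≤s (s≤s (s≤s (s≤s ()))))

  range : All (λ x → 1 ≤ x × x ≤ 4) p2143
  range = from-yes (All.all? (λ x → 1 ≤? x ×-dec x ≤? 4) p2143)

  mono : x ∈ p2143 → y ∈ p2143 → x < y → relabel a b c d x < relabel a b c d y
  mono x∈ y∈ = <-from-steps step (proj₁ (All.lookup range x∈)) (proj₂ (All.lookup range y∈))

contains⇒occ : Contains w p2143 → Occ2143 w
contains⇒occ (a ∷ b ∷ c ∷ d ∷ [] , sub , refl , iso) =
  occ a b c d sub (reflect (iso fzero (fsuc fzero)) (s<s z<s))
                  (reflect (iso (fsuc (fsuc (fsuc fzero))) fzero) (s<s (s<s z<s)))
                  (reflect (iso (fsuc (fsuc fzero)) (fsuc (fsuc (fsuc fzero)))) (s<s (s<s (s<s z<s))))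
  where
  reflect : ∀ {u v} → (x ≤ y) ⇔ (u ≤ v) → v < u → y < x
  reflect x≤y⇔u≤v v<u = ≰⇒> (λ x≤y → <⇒≱ v<u (Equivalence.to x≤y⇔u≤v x≤y))

occ-⊆ : w ⊆ w′ → Occ2143 w → Occ2143 w′
occ-⊆ w⊆w′ (occ a b c d sub b<a a<d d<c) = occ a b c d (⊆-trans sub w⊆w′) b<a a<d d<c

occ-map-suc : Occ2143 w → Occ2143 (map suc w)
occ-map-suc (occ a b c d sub b<a a<d d<c) =
  occ (suc a) (suc b) (suc c) (suc d) (⊆-map⁺ suc sub) (s<s b<a) (s<s a<d) (s<s d<c)

occ-map-suc⁻ : Occ2143 (map suc w) → Occ2143 w
occ-map-suc⁻ {w} (occ a b c d sub b<a a<d d<c) with ∈-map⁻ suc (Any-resp-⊆ sub (there (here refl)))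
occ-map-suc⁻ {w} (occ (suc a) _ (suc c) (suc d) sub (s<s b<a) (s<s a<d) (s<s d<c)) | b , _ , refl =
  occ a b c d (subst (_ ⊆_) (trans (sym (map-∘ w)) (map-id w)) (⊆-map⁺ pred sub)) b<a a<d d<c

-- Permutations of [n]

1⊕_ : List ℕ → List ℕ
1⊕ σ = 1 ∷ map suc σ

[suc]-∷ : ∀ n → [ suc n ] ≡ 1 ∷ map suc [ n ]
[suc]-∷ n = cong (λ l → 1 ∷ map suc l) (sym (map-upTo suc n))

[suc]-∷ʳ : ∀ n → [ suc n ] ≡ [ n ] ++ suc n ∷ []
[suc]-∷ʳ n = trans (cong (map suc) (sym (upTo-∷ʳ n))) (map-++ suc (upTo n) (n ∷ []))

∈-[]⁻ : x ∈ [ n ] → 1 ≤ x × x ≤ n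
∈-[]⁻ x∈ with i , i∈ , refl ← ∈-map⁻ suc x∈ = s≤s z≤n , ∈-upTo⁻ i∈

∈-[]⁺ : 1 ≤ x → x ≤ n → x ∈ [ n ]
∈-[]⁺ {suc x} _ x<n = ∈-map⁺ suc (∈-upTo⁺ x<n)

IsPerm-∈⁻ : IsPerm n π → x ∈ π → 1 ≤ x × x ≤ n
IsPerm-∈⁻ p x∈ = ∈-[]⁻ (∈-resp-↭ p x∈)

IsPerm-∈⁺ : IsPerm n π → 1 ≤ x → x ≤ n → x ∈ π
IsPerm-∈⁺ p 1≤x x≤n = ∈-resp-↭ (↭-sym p) (∈-[]⁺ 1≤x x≤n)

IsPerm-unique : IsPerm n π → Unique π
IsPerm-unique {n} p = Unique-resp-↭ (setoid ℕ) (↭⇒↭ₛ (↭-sym p)) (Unique.map⁺ suc-injective (Unique.upTo⁺ n))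

IsPerm-1⊕ : IsPerm n σ → IsPerm (suc n) (1⊕ σ)
IsPerm-1⊕ {n} p = ↭-trans (prep 1 (↭-map⁺ suc p)) (↭-reflexive (sym ([suc]-∷ n)))

IsPerm-top∷ : IsPerm n σ → IsPerm (suc n) (suc n ∷ σ)
IsPerm-top∷ {n} {σ} p =
  ↭-trans (∷↭∷ʳ (suc n) σ) (↭-trans (↭-++⁺ʳ (suc n ∷ []) p) (↭-reflexive (sym ([suc]-∷ʳ n))))

IsPerm-remove-top : ∀ ws → IsPerm (suc n) (ws ++ suc n ∷ τ) → IsPerm n (ws ++ τ)
IsPerm-remove-top {n} ws p =
  ↭-trans (drop-mid ws [ n ] (↭-trans p (↭-reflexive ([suc]-∷ʳ n)))) (↭-reflexive (++-identityʳ [ n ]))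

IsPerm-remove-1 : ∀ ws → IsPerm (suc n) (ws ++ 1 ∷ τ) → ∃ λ σ → ws ++ τ ≡ map suc σ × IsPerm n σ
IsPerm-remove-1 {n} ws p
  with σ , eq , q ← ↭-map-inv suc (↭-sym (drop-mid ws [] (↭-trans p (↭-reflexive ([suc]-∷ n))))) =
  σ , eq , ↭-sym q

-- Sublists of ππʳ

double-∷ : ∀ x π → double (x ∷ π) ≡ x ∷ (double π ++ x ∷ [])
double-∷ x π = cong (x ∷_) (trans (cong (π ++_) (unfold-reverse x π)) (sym (++-assoc π (reverse π) (x ∷ []))))

double-∷-∷ : ∀ x y π → double (x ∷ y ∷ π) ≡ x ∷ y ∷ ((double π ++ y ∷ []) ++ x ∷ [])
double-∷-∷ x y π = trans (double-∷ x (y ∷ π)) (cong (λ l → x ∷ (l ++ x ∷ [])) (double-∷ y π))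

double-map : ∀ (f : ℕ → ℕ) π → double (map f π) ≡ map f (double π)
double-map f π = trans (cong (map f π ++_) (sym (reverse-map f π))) (sym (map-++ f π (reverse π)))

double⁺ : π ⊆ σ → double π ⊆ double σ
double⁺ π⊆σ = ++⁺ π⊆σ (reverse⁺ π⊆σ)

∈-double⁻ : x ∈ double π → x ∈ π
∈-double⁻ {π = π} x∈ with ∈-++⁻ π x∈
... | inj₁ x∈π  = x∈π
... | inj₂ x∈πʳ = ∈-resp-↭ (↭-reverse π) x∈πʳ

reverse-snoc : ∀ xs (x : ℕ) → reverse (xs ++ x ∷ []) ≡ x ∷ reverse xs
reverse-snoc xs x = reverse-++ xs (x ∷ [])

⊆-drop-last : x ≢ y → s ++ x ∷ [] ⊆ w ++ y ∷ [] → s ++ x ∷ [] ⊆ w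
⊆-drop-last {x} {y} {s} {w} x≢y sub = reverse⁻ (subst (_⊆ reverse w) (sym (reverse-snoc s x))
  (∷ʳ⁻ x≢y (subst₂ _⊆_ (reverse-snoc s x) (reverse-snoc w y) (reverse⁺ sub))))

⊆-drop-second : a ≢ y → b ≢ y → a ∷ b ∷ s ⊆ x ∷ y ∷ w → a ∷ b ∷ s ⊆ x ∷ w
⊆-drop-second a≢y b≢y (x ∷ʳ sub)   = x ∷ʳ ∷ʳ⁻ a≢y sub
⊆-drop-second a≢y b≢y (refl ∷ sub) = refl ∷ ∷ʳ⁻ b≢y sub

⊆-drop-penultimate : a ≢ y → b ≢ y → (s ++ a ∷ []) ++ b ∷ [] ⊆ (w ++ y ∷ []) ++ z ∷ [] →
                     (s ++ a ∷ []) ++ b ∷ [] ⊆ w ++ z ∷ []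
⊆-drop-penultimate {a} {y} {b} {s} {w} {z} a≢y b≢y sub =
  reverse⁻ (subst₂ _⊆_ (sym reverse-s) (sym (reverse-snoc w z))
                       (⊆-drop-second b≢y a≢y (subst₂ _⊆_ reverse-s reverse-w (reverse⁺ sub))))
  where
  reverse-s : reverse ((s ++ a ∷ []) ++ b ∷ []) ≡ b ∷ a ∷ reverse s
  reverse-s = trans (reverse-snoc (s ++ a ∷ []) b) (cong (b ∷_) (reverse-snoc s a))
  reverse-w : reverse ((w ++ y ∷ []) ++ z ∷ []) ≡ z ∷ y ∷ reverse w
  reverse-w = trans (reverse-snoc (w ++ y ∷ []) z) (cong (z ∷_) (reverse-snoc w y))

⊆-double-∷⁻ : a ≢ x → d ≢ x → a ∷ b ∷ c ∷ d ∷ [] ⊆ double (x ∷ π) → a ∷ b ∷ c ∷ d ∷ [] ⊆ double π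
⊆-double-∷⁻ {a = a} {x = x} {b = b} {c = c} {π = π} a≢x d≢x sub =
  ⊆-drop-last {s = a ∷ b ∷ c ∷ []} d≢x (∷ʳ⁻ a≢x (⊆-trans sub (⊆-reflexive (double-∷ x π))))

⊆-double-drop-2nd : a ≢ y → b ≢ y → d ≢ y → d ≢ x →
                    a ∷ b ∷ c ∷ d ∷ [] ⊆ double (x ∷ y ∷ π) → a ∷ b ∷ c ∷ d ∷ [] ⊆ double (x ∷ π)
⊆-double-drop-2nd {a = a} {y = y} {b = b} {d = d} {x = x} {c = c} {π = π} a≢y b≢y d≢y d≢x sub =
  ⊆-trans without-y (⊆-trans (refl ∷ ++⁺ʳ (x ∷ []) ⊆-refl) (⊆-reflexive (sym (double-∷ x π))))
  where
  without-y : a ∷ b ∷ c ∷ d ∷ [] ⊆ x ∷ double π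
  without-y = ⊆-drop-second a≢y b≢y
    (⊆-drop-last {s = a ∷ b ∷ c ∷ []} d≢y
      (⊆-drop-last {s = a ∷ b ∷ c ∷ []} d≢x (⊆-trans sub (⊆-reflexive (double-∷-∷ x y π)))))

⊆-double-drop-2nd′ : a ≢ x → a ≢ y → c ≢ y → d ≢ y →
                     a ∷ b ∷ c ∷ d ∷ [] ⊆ double (x ∷ y ∷ π) → a ∷ b ∷ c ∷ d ∷ [] ⊆ double (x ∷ π)
⊆-double-drop-2nd′ {a = a} {x = x} {y = y} {c = c} {d = d} {b = b} {π = π} a≢x a≢y c≢y d≢y sub =
  ⊆-trans (x ∷ʳ without-y) (⊆-reflexive (sym (double-∷ x π)))
  where
  without-y : a ∷ b ∷ c ∷ d ∷ [] ⊆ double π ++ x ∷ []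
  without-y = ⊆-drop-penultimate {s = a ∷ b ∷ []} c≢y d≢y
    (∷ʳ⁻ a≢y (∷ʳ⁻ a≢x (⊆-trans sub (⊆-reflexive (double-∷-∷ x y π)))))

before-or-after : x ∈ w → y ∈ w → x ≢ y → x ∷ y ∷ [] ⊆ w ⊎ y ∷ x ∷ [] ⊆ w
before-or-after (here refl) (here refl) x≢y = ⊥-elim (x≢y refl)
before-or-after (here refl) (there y∈) _   = inj₁ (refl ∷ from∈ y∈)
before-or-after (there x∈) (here refl) _   = inj₂ (refl ∷ from∈ x∈)
before-or-after {w = v ∷ _} (there x∈) (there y∈) x≢y
  with before-or-after x∈ y∈ x≢y
... | inj₁ xy = inj₁ (v ∷ʳ xy)
... | inj₂ yx = inj₂ (v ∷ʳ yx)

⊆-chain : Unique w → x ∷ y ∷ [] ⊆ w → y ∷ z ∷ [] ⊆ w → x ∷ y ∷ z ∷ [] ⊆ w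
⊆-chain (_ ∷ u) (v ∷ʳ xy) (.v ∷ʳ yz) = v ∷ʳ ⊆-chain u xy yz
⊆-chain _       (refl ∷ _) (v ∷ʳ yz) = refl ∷ yz
⊆-chain (v∉ ∷ _) (v ∷ʳ xy) (refl ∷ _) = ⊥-elim (All.lookup v∉ (Any-resp-⊆ xy (there (here refl))) refl)
⊆-chain (v∉ ∷ _) (refl ∷ y) (refl ∷ _) = ⊥-elim (All.lookup v∉ (Any-resp-⊆ y (here refl)) refl)

occurrence : ∀ s t → s ++ reverse t ≡ a ∷ b ∷ c ∷ d ∷ [] → s ⊆ π → t ⊆ π →
             b < a → a < d → d < c → Occ2143 (double π)
occurrence {a} {b} {c} {d} s t eq s⊆π t⊆π =
  occ a b c d (⊆-trans (⊆-reflexive (sym eq)) (++⁺ s⊆π (reverse⁺ t⊆π)))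

-- The avoiders

Avoider : ℕ → List ℕ → Set
Avoider n π = IsPerm n π × ¬ Occ2143 (double π)

word-range : IsPerm n π → a ∷ b ∷ c ∷ d ∷ [] ⊆ double π → 1 ≤ b × c ≤ n
word-range p sub = proj₁ (in-range (there (here refl))) , proj₂ (in-range (there (there (here refl))))
  where in-range = λ {x} x∈ → IsPerm-∈⁻ {x = x} p (∈-double⁻ (Any-resp-⊆ sub x∈))

short-avoids : n ≤ 3 → IsPerm n π → ¬ Occ2143 (double π)
short-avoids n≤3 p (occ a b c d sub b<a a<d d<c) =
  <⇒≱ (≤-<-trans (≤-<-trans (≤-<-trans (proj₁ (word-range p sub)) b<a) a<d) d<c)
      (≤-trans (proj₂ (word-range p sub)) n≤3)

avoids-⊆ : π ⊆ σ → ¬ Occ2143 (double σ) → ¬ Occ2143 (double π)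
avoids-⊆ π⊆σ av = av ∘ occ-⊆ (double⁺ π⊆σ)

avoids-map-suc : ¬ Occ2143 (double σ) → ¬ Occ2143 (double (map suc σ))
avoids-map-suc {σ} av o = av (occ-map-suc⁻ (subst Occ2143 (double-map suc σ) o))

avoids-map-suc⁻ : ¬ Occ2143 (double (map suc σ)) → ¬ Occ2143 (double σ)
avoids-map-suc⁻ {σ} av o = av (subst Occ2143 (sym (double-map suc σ)) (occ-map-suc o))

1⊕-avoider : Avoider n σ → Avoider (suc n) (1⊕ σ)
1⊕-avoider {σ = σ} (p , av) = p′ , avoid
  where
  p′ = IsPerm-1⊕ p
  avoid : ¬ Occ2143 (double (1⊕ σ))
  avoid (occ a b c d sub b<a a<d d<c) =
    avoids-map-suc {σ = σ} av
      (occ a b c d (⊆-double-∷⁻ {π = map suc σ} (>⇒≢ 1<a) (>⇒≢ (<-trans 1<a a<d)) sub) b<a a<d d<c)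
    where 1<a = ≤-<-trans (proj₁ (word-range p′ sub)) b<a

top∷-avoider : Avoider n σ → Avoider (suc n) (suc n ∷ σ)
top∷-avoider {n} {σ} (p , av) = p′ , avoid
  where
  p′ = IsPerm-top∷ p
  avoid : ¬ Occ2143 (double (suc n ∷ σ))
  avoid (occ a b c d sub b<a a<d d<c) =
    av (occ a b c d (⊆-double-∷⁻ {π = σ} (<⇒≢ (<-≤-trans (<-trans a<d d<c) c≤n)) (<⇒≢ (<-≤-trans d<c c≤n)) sub)
                    b<a a<d d<c)
    where c≤n = proj₂ (word-range p′ sub)

2∷top∷-avoider : Avoider (suc n) (2 ∷ τ) → Avoider (2 + n) (2 ∷ 2 + n ∷ τ)
2∷top∷-avoider {n} {τ} (p , av) = p′ , avoid
  where
  p′ = ↭-trans (swap 2 (2 + n) ↭-refl) (IsPerm-top∷ p)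
  avoid : ¬ Occ2143 (double (2 ∷ 2 + n ∷ τ))
  avoid (occ a b c d sub b<a a<d d<c) =
    av (occ a b c d (⊆-double-drop-2nd {π = τ} (below-top (<-trans a<d d<c))
                                                (below-top (<-trans (<-trans b<a a<d) d<c))
                                                (below-top d<c) (>⇒≢ (≤-<-trans 1<a a<d)) sub)
                    b<a a<d d<c)
    where
    1<a = ≤-<-trans (proj₁ (word-range p′ sub)) b<a
    below-top : x < c → x ≢ 2 + n
    below-top x<c = <⇒≢ (<-≤-trans x<c (proj₂ (word-range p′ sub)))

penult∷1⊕-avoider : Avoider (suc n) (n ∷ τ) → Avoider (2 + n) (suc n ∷ 1⊕ τ)
penult∷1⊕-avoider {n} {τ} (p , av) = p′ , avoid
  where
  p′ = ↭-trans (swap (suc n) 1 ↭-refl) (IsPerm-1⊕ p)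
  avoid : ¬ Occ2143 (double (suc n ∷ 1⊕ τ))
  avoid (occ a b c d sub b<a a<d d<c) =
    avoids-map-suc {σ = n ∷ τ} av
      (occ a b c d (⊆-double-drop-2nd′ {π = map suc τ} (<⇒≢ a<1+n) (>⇒≢ 1<a) (>⇒≢ (<-trans 1<a (<-trans a<d d<c)))
                                                        (>⇒≢ (<-trans 1<a a<d)) sub)
                   b<a a<d d<c)
    where
    1<a = ≤-<-trans (proj₁ (word-range p′ sub)) b<a
    a<1+n = <-≤-trans a<d (≤-pred (<-≤-trans d<c (proj₂ (word-range p′ sub))))

-- after2 m: the τ for which 2 ∷ τ avoids in 𝒮_(m+3), namely (m+3) (m+2) ⋯ 4 followed by 1 3 or 3 1
after2 : ℕ → List (List ℕ)
after2 zero    = (1 ∷ 3 ∷ []) ∷ (3 ∷ 1 ∷ []) ∷ []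
after2 (suc m) = map (4 + m ∷_) (after2 m)

-- afterPenult m: the τ for which (m+2) ∷ τ avoids in 𝒮_(m+3)
afterPenult : ℕ → List (List ℕ)
afterPenult zero    = after2 zero
afterPenult (suc m) = map 1⊕_ (afterPenult m)

-- the avoiders in 𝒮_n whose first entry is neither 1 nor n
exceptional : ℕ → List (List ℕ)
exceptional (suc (suc (suc zero)))     = map (2 ∷_) (after2 0)
exceptional (suc (suc (suc (suc m)))) = map (2 ∷_) (after2 (suc m)) ++ map (3 + m ∷_) (afterPenult (suc m))
exceptional _                          = []

avoiders : ℕ → List (List ℕ)
avoiders zero          = [] ∷ []
avoiders (suc zero)    = (1 ∷ []) ∷ []
avoiders (suc (suc n)) = map 1⊕_ (avoiders (suc n)) ++ map (2 + n ∷_) (avoiders (suc n)) ++ exceptional (2 + n)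

after2-sound : ∀ m → All (λ τ → Avoider (3 + m) (2 ∷ τ)) (after2 m)
after2-sound zero    = (p₁ , short-avoids ≤-refl p₁) ∷ (p₂ , short-avoids ≤-refl p₂) ∷ []
  where
  p₁ = swap 2 1 ↭-refl
  p₂ = ↭-trans (prep 2 (swap 3 1 ↭-refl)) (swap 2 1 ↭-refl)
after2-sound (suc m) = All.map⁺ (All.map 2∷top∷-avoider (after2-sound m))

afterPenult-sound : ∀ m → All (λ τ → Avoider (3 + m) (2 + m ∷ τ)) (afterPenult m)
afterPenult-sound zero    = after2-sound zero
afterPenult-sound (suc m) = All.map⁺ (All.map penult∷1⊕-avoider (afterPenult-sound m))

exceptional-sound : ∀ n → All (Avoider n) (exceptional n)
exceptional-sound (suc (suc (suc zero)))     = All.map⁺ (after2-sound 0)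
exceptional-sound (suc (suc (suc (suc m)))) =
  All.++⁺ (All.map⁺ (after2-sound (suc m))) (All.map⁺ (afterPenult-sound (suc m)))
exceptional-sound zero                       = []
exceptional-sound (suc zero)                 = []
exceptional-sound (suc (suc zero))           = []

avoiders-sound : ∀ n → All (Avoider n) (avoiders n)
avoiders-sound zero          = (↭-refl , short-avoids z≤n ↭-refl) ∷ []
avoiders-sound (suc zero)    = (↭-refl , short-avoids (s≤s z≤n) ↭-refl) ∷ []
avoiders-sound (suc (suc n)) =
  All.++⁺ (All.map⁺ (All.map 1⊕-avoider (avoiders-sound (suc n))))
          (All.++⁺ (All.map⁺ (All.map top∷-avoider (avoiders-sound (suc n)))) (exceptional-sound (2 + n)))

-- Completeness of the classification

Avoider-remove-top : ∀ ws → Avoider (suc n) (ws ++ suc n ∷ τ) → Avoider n (ws ++ τ)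
Avoider-remove-top {n} {τ} ws (p , av) =
  IsPerm-remove-top ws p , avoids-⊆ {σ = ws ++ suc n ∷ τ} (++⁺ ⊆-refl (suc n ∷ʳ ⊆-refl)) av

Avoider-remove-1 : ∀ ws → Avoider (suc n) (ws ++ 1 ∷ τ) → ∃ λ σ → ws ++ τ ≡ map suc σ × Avoider n σ
Avoider-remove-1 {τ = τ} ws (p , av) with σ , eq , q ← IsPerm-remove-1 ws p =
  σ , eq , q , avoids-map-suc⁻ {σ = σ} (subst (λ l → ¬ Occ2143 (double l)) eq
                                      (avoids-⊆ {σ = ws ++ 1 ∷ τ} (++⁺ ⊆-refl (1 ∷ʳ ⊆-refl)) av))

∈-tail-of-perm : IsPerm n (h ∷ τ) → 1 ≤ x → x ≤ n → x ≢ h → x ∈ τ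
∈-tail-of-perm p 1≤x x≤n x≢h = Any.tail x≢h (IsPerm-∈⁺ p 1≤x x≤n)

head≢second : IsPerm n (h ∷ x ∷ ρ) → h ≢ x
head≢second p with (h≢x ∷ _) ∷ _ ← IsPerm-unique p = h≢x

data HeadCase : ℕ → ℕ → Set where
  bottom : HeadCase (suc n) 1
  top    : HeadCase (suc n) (suc n)
  second : ∀ m → HeadCase (3 + m) 2
  penult : ∀ m → HeadCase (4 + m) (3 + m)
  middle : 3 ≤ h → suc h < n → HeadCase n h

headCase : 1 ≤ h × h ≤ n → HeadCase n h
headCase {1} {suc n} _ = bottom
headCase {2} {1} (_ , s≤s ())
headCase {2} {2} _ = top
headCase {2} {suc (suc (suc m))} _ = second m
headCase {suc (suc (suc h))} (_ , h≤n) with m≤n⇒m<n∨m≡n h≤n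
... | inj₂ refl = top
... | inj₁ h<n with m≤n⇒m<n∨m≡n h<n
...   | inj₂ refl = penult h
...   | inj₁ h+1<n = middle (s≤s (s≤s (s≤s z≤n))) h+1<n

2∷1∷-occurrence : IsPerm (4 + m) (2 ∷ 1 ∷ ρ) → Occ2143 (double (2 ∷ 1 ∷ ρ))
2∷1∷-occurrence {m} {ρ} p =
  [ (λ 3,N → occurrence (2 ∷ 1 ∷ []) (3 ∷ 4 + m ∷ []) refl (refl ∷ refl ∷ minimum ρ) (2 ∷ʳ 1 ∷ʳ 3,N) 1<2 2<3 3<N)
  , (λ N,3 → occurrence (2 ∷ 1 ∷ 4 + m ∷ 3 ∷ []) [] refl (refl ∷ refl ∷ N,3) (minimum _) 1<2 2<3 3<N)
  ]′ (before-or-after 3∈ρ N∈ρ (λ ()))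
  where
  1<2 : 1 < 2
  1<2 = s<s z<s
  2<3 : 2 < 3
  2<3 = s<s 1<2
  3<N : 3 < 4 + m
  3<N = s<s (s<s (s<s z<s))
  3∈ρ = Any.tail (λ ()) (∈-tail-of-perm p (s≤s z≤n) (<⇒≤ 3<N) (λ ()))
  N∈ρ = Any.tail (λ ()) (∈-tail-of-perm p (s≤s z≤n) ≤-refl (λ ()))

2∷x-occurrence : IsPerm (3 + m) (2 ∷ x ∷ ρ) → x ≢ 1 → x ≢ 3 + m → Occ2143 (double (2 ∷ x ∷ ρ))
2∷x-occurrence {m} {x} p x≢1 x≢N =
  occurrence (2 ∷ 1 ∷ []) (x ∷ 3 + m ∷ []) refl (refl ∷ x ∷ʳ from∈ 1∈ρ) (2 ∷ʳ refl ∷ from∈ N∈ρ)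
             (s<s z<s) 2<x (≤∧≢⇒< (proj₂ x-range) x≢N)
  where
  x-range = IsPerm-∈⁻ p (there (here refl))
  2<x = ≤∧≢⇒< (≤∧≢⇒< (proj₁ x-range) (x≢1 ∘ sym)) (head≢second p)
  1∈ρ = Any.tail (x≢1 ∘ sym) (∈-tail-of-perm p (s≤s z≤n) (s≤s z≤n) (λ ()))
  N∈ρ = Any.tail (x≢N ∘ sym) (∈-tail-of-perm p (s≤s z≤n) ≤-refl (λ ()))

penult∷top-occurrence : IsPerm (4 + m) (3 + m ∷ 4 + m ∷ ρ) → Occ2143 (double (3 + m ∷ 4 + m ∷ ρ))
penult∷top-occurrence {m} {ρ} p =
  [ (λ k-1,1 → occurrence (2 + m ∷ 1 ∷ []) (3 + m ∷ 4 + m ∷ []) refl (_ ∷ʳ _ ∷ʳ k-1,1) (refl ∷ refl ∷ minimum ρ)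
                          (s<s z<s) (n<1+n _) (n<1+n _))
  , (λ 1,k-1 → occurrence [] (3 + m ∷ 4 + m ∷ 1 ∷ 2 + m ∷ []) refl (minimum _) (refl ∷ refl ∷ 1,k-1)
                          (s<s z<s) (n<1+n _) (n<1+n _))
  ]′ (before-or-after k-1∈ρ 1∈ρ (λ ()))
  where
  1∈ρ = Any.tail (λ ()) (∈-tail-of-perm p (s≤s z≤n) (s≤s z≤n) (λ ()))
  k-1∈ρ = Any.tail (<⇒≢ (<-trans (n<1+n _) (n<1+n _)))
                   (∈-tail-of-perm p (s≤s z≤n) (s≤s (s≤s (m≤n+m m 2))) (<⇒≢ (n<1+n _)))

penult∷x-occurrence : IsPerm (4 + m) (3 + m ∷ x ∷ ρ) → x ≢ 1 → x ≢ 4 + m → Occ2143 (double (3 + m ∷ x ∷ ρ))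
penult∷x-occurrence {m} {x} p x≢1 x≢N =
  occurrence (x ∷ 1 ∷ []) (3 + m ∷ 4 + m ∷ []) refl (_ ∷ʳ refl ∷ from∈ 1∈ρ) (refl ∷ _ ∷ʳ from∈ N∈ρ)
             (≤∧≢⇒< (proj₁ x-range) (x≢1 ∘ sym)) x<k (n<1+n _)
  where
  x-range = IsPerm-∈⁻ p (there (here refl))
  x<k = ≤∧≢⇒< (≤-pred (≤∧≢⇒< (proj₂ x-range) x≢N)) (head≢second p ∘ sym)
  1∈ρ = Any.tail (x≢1 ∘ sym) (∈-tail-of-perm p (s≤s z≤n) (s≤s z≤n) (λ ()))
  N∈ρ = Any.tail (x≢N ∘ sym) (∈-tail-of-perm p (s≤s z≤n) ≤-refl (>⇒≢ (n<1+n _)))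

module _ {n g τ} (p : IsPerm n (suc g ∷ τ)) (2≤g : 2 ≤ g) (h+1<n : 2 + g < n) where
  private
    1<h : 1 < suc g
    1<h = s≤s (<⇒≤ 2≤g)
    h<n : suc g < n
    h<n = <-trans (n<1+n _) h+1<n
    1∈τ : 1 ∈ τ
    1∈τ = ∈-tail-of-perm p (s≤s z≤n) (<⇒≤ (<-trans 1<h h<n)) (<⇒≢ 1<h)
    n∈τ : n ∈ τ
    n∈τ = ∈-tail-of-perm p (≤-<-trans z≤n h<n) ≤-refl (>⇒≢ h<n)
    g∈τ : g ∈ τ
    g∈τ = ∈-tail-of-perm p (<⇒≤ 2≤g) (<⇒≤ (<-trans (n<1+n _) h<n)) (<⇒≢ (n<1+n _))
    τ-unique : Unique τ
    τ-unique with _ ∷ u ← IsPerm-unique p = u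

  middle-occurrence : Occ2143 (double (suc g ∷ τ))
  middle-occurrence with before-or-after 1∈τ n∈τ (<⇒≢ (<-trans 1<h h<n))
  ... | inj₁ 1,n = occurrence (suc g ∷ 1 ∷ n ∷ []) (2 + g ∷ []) refl (refl ∷ 1,n)
                     (from∈ (IsPerm-∈⁺ p (s≤s z≤n) (<⇒≤ h+1<n))) 1<h (n<1+n _) h+1<n
  ... | inj₂ n,1 with before-or-after g∈τ 1∈τ (>⇒≢ 2≤g)
  ...   | inj₁ g,1 = occurrence (g ∷ 1 ∷ []) (suc g ∷ n ∷ []) refl (suc g ∷ʳ g,1) (refl ∷ from∈ n∈τ)
                       2≤g (n<1+n _) h<n
  ...   | inj₂ 1,g = occurrence [] (suc g ∷ n ∷ 1 ∷ g ∷ []) refl (minimum _)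
                       (refl ∷ ⊆-chain τ-unique n,1 1,g) 2≤g (n<1+n _) h<n

after2-complete : ∀ m τ → Avoider (3 + m) (2 ∷ τ) → τ ∈ after2 m

after2-1∷ : ∀ m ρ → Avoider (3 + m) (2 ∷ 1 ∷ ρ) → 1 ∷ ρ ∈ after2 m
after2-1∷ zero    ρ (p , _) with refl ← ↭-singleton-inv (drop-∷ (drop-mid (2 ∷ []) [] p)) = here refl
after2-1∷ (suc m) ρ (p , av) = ⊥-elim (av (2∷1∷-occurrence p))

after2-top∷ : ∀ m ρ → Avoider (3 + m) (2 ∷ 3 + m ∷ ρ) → 3 + m ∷ ρ ∈ after2 m
after2-top∷ zero ρ (p , _) with refl ← ↭-singleton-inv (IsPerm-remove-top [] (IsPerm-remove-top (2 ∷ []) p)) =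
  there (here refl)
after2-top∷ (suc m) ρ av = ∈-map⁺ (4 + m ∷_) (after2-complete m ρ (Avoider-remove-top (2 ∷ []) av))

after2-complete m []      (p , _) with () ← ∈-tail-of-perm p (s≤s z≤n) (s≤s z≤n) (λ ())
after2-complete m (x ∷ ρ) (p , av) with x ≟ 1 | x ≟ 3 + m
... | yes refl | _        = after2-1∷ m ρ (p , av)
... | no _     | yes refl = after2-top∷ m ρ (p , av)
... | no x≢1   | no x≢N   = ⊥-elim (av (2∷x-occurrence p x≢1 x≢N))

afterPenult-complete : ∀ m τ → Avoider (3 + m) (2 + m ∷ τ) → τ ∈ afterPenult m
afterPenult-complete zero    = after2-complete zero
afterPenult-complete (suc m) []      (p , _) with () ← ∈-tail-of-perm p (s≤s z≤n) (s≤s z≤n) (λ ())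
afterPenult-complete (suc m) (x ∷ ρ) (p , av) with x ≟ 1 | x ≟ 4 + m
... | yes refl | _ with (_ ∷ σ) , refl , av′ ← Avoider-remove-1 (3 + m ∷ []) (p , av) =
  ∈-map⁺ 1⊕_ (afterPenult-complete m σ av′)
... | no _   | yes refl = ⊥-elim (av (penult∷top-occurrence p))
... | no x≢1 | no x≢N   = ⊥-elim (av (penult∷x-occurrence p x≢1 x≢N))

1⊕-∈-avoiders : ∀ n → σ ∈ avoiders n → 1⊕ σ ∈ avoiders (suc n)
1⊕-∈-avoiders zero    (here refl) = here refl
1⊕-∈-avoiders (suc n) σ∈          = ∈-++⁺ˡ (∈-map⁺ 1⊕_ σ∈)

top∷-∈-avoiders : ∀ n → σ ∈ avoiders n → suc n ∷ σ ∈ avoiders (suc n)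
top∷-∈-avoiders zero    (here refl) = here refl
top∷-∈-avoiders (suc n) σ∈          = ∈-++⁺ʳ (map 1⊕_ (avoiders (suc n))) (∈-++⁺ˡ (∈-map⁺ (2 + n ∷_) σ∈))

exceptional-∈-avoiders : ∀ n → π ∈ exceptional (2 + n) → π ∈ avoiders (2 + n)
exceptional-∈-avoiders n π∈ =
  ∈-++⁺ʳ (map 1⊕_ (avoiders (suc n))) (∈-++⁺ʳ (map (2 + n ∷_) (avoiders (suc n))) π∈)

2∷-∈-exceptional : ∀ m → τ ∈ after2 m → 2 ∷ τ ∈ exceptional (3 + m)
2∷-∈-exceptional zero    τ∈ = ∈-map⁺ (2 ∷_) τ∈
2∷-∈-exceptional (suc m) τ∈ = ∈-++⁺ˡ (∈-map⁺ (2 ∷_) τ∈)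

penult∷-∈-exceptional : ∀ m → τ ∈ afterPenult (suc m) → 3 + m ∷ τ ∈ exceptional (4 + m)
penult∷-∈-exceptional m τ∈ = ∈-++⁺ʳ (map (2 ∷_) (after2 (suc m))) (∈-map⁺ (3 + m ∷_) τ∈)

avoiders-complete : ∀ n π → Avoider n π → π ∈ avoiders n
avoiders-complete zero    π       (p , _) with refl ← ↭-empty-inv p = here refl
avoiders-complete (suc n) []      (p , _) with () ← IsPerm-∈⁺ p (s≤s z≤n) (s≤s z≤n)
avoiders-complete (suc n) (h ∷ τ) (p , av) with headCase (IsPerm-∈⁻ p (here refl))
... | bottom with σ , refl , av′ ← Avoider-remove-1 [] (p , av) = 1⊕-∈-avoiders n (avoiders-complete n σ av′)
... | top = top∷-∈-avoiders n (avoiders-complete n τ (Avoider-remove-top [] (p , av)))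
... | second m = exceptional-∈-avoiders (suc m) (2∷-∈-exceptional m (after2-complete m τ (p , av)))
... | penult m = exceptional-∈-avoiders (2 + m) (penult∷-∈-exceptional m (afterPenult-complete (suc m) τ (p , av)))
... | middle (s≤s 2≤g) h+1<n = ⊥-elim (av (middle-occurrence p 2≤g h+1<n))

-- Counting

data StartsIn (P : ℕ → Set) : List ℕ → Set where
  start : P h → StartsIn P (h ∷ τ)

map-∷-startsIn : ∀ {P} → P h → ∀ xs → All (StartsIn P) (map (h ∷_) xs)
map-∷-startsIn Ph xs = All.map⁺ (All.universal (λ _ → start Ph) xs)

disjoint-by-start : ∀ {P Q xs ys} → (∀ {h} → P h → Q h → ⊥) →
                    All (StartsIn P) xs → All (StartsIn Q) ys → Disjoint xs ys
disjoint-by-start P∩Q=∅ Pxs Qys (v∈xs , v∈ys) with All.lookup Pxs v∈xs | All.lookup Qys v∈ys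
... | start Ph | start Qh = P∩Q=∅ Ph Qh

exceptional-startsIn : ∀ n → All (StartsIn (λ h → 2 ≤ h × h < n)) (exceptional n)
exceptional-startsIn (suc (suc (suc zero)))     = map-∷-startsIn (≤-refl , ≤-refl) (after2 0)
exceptional-startsIn (suc (suc (suc (suc m)))) =
  All.++⁺ (map-∷-startsIn (≤-refl , s<s (s<s z<s)) (after2 (suc m)))
          (map-∷-startsIn (s≤s (s≤s z≤n) , n<1+n _) (afterPenult (suc m)))
exceptional-startsIn zero                       = []
exceptional-startsIn (suc zero)                 = []
exceptional-startsIn (suc (suc zero))           = []

map-∷-unique : ∀ (h : ℕ) {xs} → Unique xs → Unique (map (h ∷_) xs)
map-∷-unique h = Unique.map⁺ {f = h ∷_} ∷-injectiveʳ

map-1⊕-unique : ∀ {xs : List (List ℕ)} → Unique xs → Unique (map 1⊕_ xs)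
map-1⊕-unique = Unique.map⁺ {f = 1⊕_} (map-injective suc-injective ∘ ∷-injectiveʳ)

after2-unique : ∀ m → Unique (after2 m)
after2-unique zero    = ((λ ()) ∷ []) ∷ [] ∷ []
after2-unique (suc m) = map-∷-unique (4 + m) (after2-unique m)

afterPenult-unique : ∀ m → Unique (afterPenult m)
afterPenult-unique zero    = after2-unique zero
afterPenult-unique (suc m) = map-1⊕-unique (afterPenult-unique m)

exceptional-unique : ∀ n → Unique (exceptional n)
exceptional-unique (suc (suc (suc zero)))     = map-∷-unique 2 (after2-unique 0)
exceptional-unique (suc (suc (suc (suc m)))) =
  Unique.++⁺ (map-∷-unique 2 (after2-unique (suc m))) (map-∷-unique (3 + m) (afterPenult-unique (suc m)))
             (disjoint-by-start {P = _≡ 2} {Q = _≡ 3 + m} (λ { refl () })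
                                (map-∷-startsIn refl (after2 (suc m))) (map-∷-startsIn refl (afterPenult (suc m))))
exceptional-unique zero                       = []
exceptional-unique (suc zero)                 = []
exceptional-unique (suc (suc zero))           = []

avoiders-unique : ∀ n → Unique (avoiders n)
avoiders-unique zero          = [] ∷ []
avoiders-unique (suc zero)    = [] ∷ []
avoiders-unique (suc (suc n)) =
  Unique.++⁺ (map-1⊕-unique (avoiders-unique (suc n)))
             (Unique.++⁺ (map-∷-unique (2 + n) (avoiders-unique (suc n))) (exceptional-unique (2 + n))
                         top∩exceptional=∅)
             bottom∩rest=∅
  where
  A = avoiders (suc n)

  top∩exceptional=∅ : Disjoint (map (2 + n ∷_) A) (exceptional (2 + n))
  top∩exceptional=∅ = disjoint-by-start {P = _≡ 2 + n} (λ { refl (_ , n<n) → <-irrefl refl n<n })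
                        (map-∷-startsIn refl A) (exceptional-startsIn (2 + n))

  bottom∩rest=∅ : Disjoint (map 1⊕_ A) (map (2 + n ∷_) A ++ exceptional (2 + n))
  bottom∩rest=∅ = disjoint-by-start {P = _≡ 1} {Q = 2 ≤_} (λ { refl 2≤1 → <-irrefl refl 2≤1 })
    (All.map⁺ (All.universal (λ _ → start refl) A))
    (All.++⁺ (map-∷-startsIn (s≤s (s≤s z≤n)) A)
             (All.map (λ { (start (2≤h , _)) → start 2≤h }) (exceptional-startsIn (2 + n))))

length-after2 : ∀ m → length (after2 m) ≡ 2
length-after2 zero    = refl
length-after2 (suc m) = trans (length-map (4 + m ∷_) (after2 m)) (length-after2 m)

length-afterPenult : ∀ m → length (afterPenult m) ≡ 2
length-afterPenult zero    = refl
length-afterPenult (suc m) = trans (length-map 1⊕_ (afterPenult m)) (length-afterPenult m)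

length-exceptional : ∀ m → length (exceptional (4 + m)) ≡ 4
length-exceptional m =
  trans (length-++ (map (2 ∷_) (after2 (suc m))))
        (cong₂ _+_ (trans (length-map (2 ∷_) (after2 (suc m))) (length-after2 (suc m)))
                   (trans (length-map (3 + m ∷_) (afterPenult (suc m))) (length-afterPenult (suc m))))

length-avoiders-suc : ∀ n → let ℓ = length (avoiders (suc n)) in
                      length (avoiders (2 + n)) ≡ ℓ + (ℓ + length (exceptional (2 + n)))
length-avoiders-suc n =
  trans (length-++ (map 1⊕_ A))
        (cong₂ _+_ (length-map 1⊕_ A)
                   (trans (length-++ (map (2 + n ∷_) A)) (cong (_+ length (exceptional (2 + n))) (length-map (2 + n ∷_) A))))
  where A = avoiders (suc n)

length-avoiders : ∀ m → length (avoiders (3 + m)) + 4 ≡ 5 * 2 ^ suc m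
length-avoiders zero    = refl
length-avoiders (suc m) = begin
  length (avoiders (4 + m)) + 4
    ≡⟨ cong (_+ 4) (trans (length-avoiders-suc (2 + m)) (cong (λ e → ℓ + (ℓ + e)) (length-exceptional m))) ⟩
  ℓ + (ℓ + 4) + 4    ≡⟨ twice ℓ ⟩
  2 * (ℓ + 4)        ≡⟨ cong (2 *_) (length-avoiders m) ⟩
  2 * (5 * 2 ^ suc m) ≡⟨ commute (2 ^ suc m) ⟩
  5 * 2 ^ suc (suc m) ∎
  where
  open ≡-Reasoning
  ℓ = length (avoiders (3 + m))
  twice : ∀ ℓ → ℓ + (ℓ + 4) + 4 ≡ 2 * (ℓ + 4)
  twice = solve-∀
  commute : ∀ y → 2 * (5 * y) ≡ 5 * (2 * y)
  commute = solve-∀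

avoider⇔counted : Avoider n π ⇔ Counted n p2143 π
avoider⇔counted = mk⇔ (λ (p , av) → p , av ∘ contains⇒occ) (λ (p , av) → p , av ∘ occ⇒contains)

theorem11 : (n : ℕ) → 3 ≤ n → HasCount n p2143 (5 * 2 ^ (n ∸ 2) ∸ 4)
theorem11 (suc zero)       (s≤s ())
theorem11 (suc (suc zero)) (s≤s (s≤s ()))
theorem11 (suc (suc (suc m))) _ =
  avoiders N , avoiders-unique N ,
  (λ π → mk⇔ (to avoider⇔counted ∘ All.lookup (avoiders-sound N))
              (avoiders-complete N π ∘ from avoider⇔counted)) ,
  trans (sym (m+n∸n≡m (length (avoiders N)) 4)) (cong (_∸ 4) (length-avoiders m))
  where
  N = 3 + m
  open Equivalence
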